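{- If $G=(V,E)$ is an edgeless (empty) graph, then $G$ is a $2$-complete square-free uniform word-representable graph.
   Context: For a word $w$ and a set $S$ of letters, $w_S$ is the word obtained from $w$ by deleting all letters not in $S$. Two distinct letters $x,y$ alternate in $w$ if $w_{\{x,y\}}$ is of the form $xyxy\cdots$ or $yxyx\cdots$ (even or odd length). A simple graph $G=(V,E)$ is word-representable if there is a word $w$ over $V$, containing every vertex, such that distinct $x,y$ alternate in $w$ iff $xy\in E$. A word is uniform if every letter occurs in it the same number of times. A square is a factor (block of consecutive letters) $XX$ with $X$ non-empty. A word $w$ contains a $p$-complete square if there is a set $S$ of letters such that $w_S$ contains a square $XX$ with $|X|\ge p$; otherwise $w$ is $p$-complete square-free. A graph $G$ is $p$-complete square-free uniform word-representable if it is represented by a uniform word $w$ that is $p$-complete square-free, where $1\le p\le\lceil|w|/2\rceil$. -}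

module Defs where

open import Data.Nat using (ℕ; zero; suc; _≤_; ⌈_/2⌉)
open import Data.Fin using (Fin; _≟_)
open import Data.Bool using (Bool; true; false)
open import Data.List using (List; []; _∷_; _++_; length; filter)
open import Data.List.Membership.Propositional using (_∈_)
open import Data.Product using (Σ; ∃; ∃-syntax; _×_)
open import Data.Sum using (_⊎_)
open import Data.Empty using (⊥)
open import Relation.Nullary using (¬_)
open import Relation.Binary.PropositionalEquality using (_≡_; _≢_)
open import Function.Bundles using (_⇔_)

record SimpleGraph : Set₁ where
  field
    n      : ℕ
    Adj    : Fin n → Fin n → Set
    sym    : ∀ {x y} → Adj x y → Adj y x
    irrefl : ∀ {x} → ¬ Adj x x
open SimpleGraph public

Edgeless : SimpleGraph → Set
Edgeless G = ∀ x y → ¬ Adj G x y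

Word : ℕ → Set
Word n = List (Fin n)

restrict : ∀ {n} → (Fin n → Bool) → Word n → Word n
restrict S [] = []
restrict S (x ∷ w) with S x
... | true = x ∷ restrict S w
... | false = restrict S w

pair : ∀ {n} → Fin n → Fin n → Fin n → Bool
pair x y z with z ≟ x | z ≟ y
... | Relation.Nullary.yes _ | _ = true
... | Relation.Nullary.no _ | Relation.Nullary.yes _ = true
... | Relation.Nullary.no _ | Relation.Nullary.no _ = false

altWord : ∀ {n} → Fin n → Fin n → ℕ → Word n
altWord x y zero = []
altWord x y (suc k) = x ∷ altWord y x k

Alternate : ∀ {n} → Word n → Fin n → Fin n → Set
Alternate w x y =
  x ≢ y × (∃[ k ] (restrict (pair x y) w ≡ altWord x y k ⊎ restrict (pair x y) w ≡ altWord y x k))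

Represents : (G : SimpleGraph) → Word (n G) → Set
Represents G w =
  (∀ x → x ∈ w) × (∀ x y → x ≢ y → (Alternate w x y ⇔ Adj G x y))

occ : ∀ {n} → Fin n → Word n → ℕ
occ x w = length (filter (_≟ x) w)

Uniform : ∀ {n} → Word n → Set
Uniform w = ∃[ k ] (∀ x → occ x w ≡ k)

HasSquareFactor : ∀ {n} → ℕ → Word n → Set
HasSquareFactor {n} p u =
  Σ (Word n) λ a → Σ (Word n) λ X → Σ (Word n) λ b →
    (u ≡ a ++ X ++ X ++ b) × (1 ≤ length X) × (p ≤ length X)

ContainsCompleteSquare : ∀ {n} → ℕ → Word n → Set
ContainsCompleteSquare {n} p w = Σ (Fin n → Bool) λ S → HasSquareFactor p (restrict S w)

CompleteSquareFree : ∀ {n} → ℕ → Word n → Set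
CompleteSquareFree p w = ¬ ContainsCompleteSquare p w

PCSFUWR : ℕ → SimpleGraph → Set
PCSFUWR p G = Σ (Word (n G)) λ w →
  Represents G w × Uniform w × CompleteSquareFree p w × 1 ≤ p × p ≤ ⌈ length w /2⌉

{-# OPTIONS --safe #-}
module Submission where

-- Take w = 0 0 0 1 1 1 ⋯, each letter three times in increasing order. Every
-- restriction of a sorted word is sorted, and in a sorted word everything between
-- two copies of a letter c equals c. Hence a square X X forces X = c c ⋯ c, so
-- |X| ≥ 2 needs four copies of c. Likewise x y x forces x = y, so an alternating
-- restriction to {x, y} has length at most 2 and cannot hold all copies of x.
-- Two copies per letter would suffice but for n = 1, where ⌈|w|/2⌉ ≥ 2 needs |w| ≥ 3.

open import Defs hiding (sym)
open import Data.Nat as ℕ using (ℕ; zero; suc; _+_; _*_; _<_; _≤_; ⌈_/2⌉; z≤n; s≤s)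
import Data.Nat.Properties as ℕ
open import Data.Fin as Fin using (Fin; _≟_)
open import Data.Fin.Properties using (suc-injective; ≤-antisym)
open import Data.Bool using (Bool; true; false; T; T?)
open import Data.Unit using (tt)
open import Data.List using (List; []; _∷_; _++_; [_]; length; filter; map; replicate)
open import Data.List.Properties using (filter-++; filter-all; filter-none; filter-accept; filter-reject; length-++; length-replicate)
open import Data.List.Relation.Unary.All as All using (All; []; _∷_)
import Data.List.Relation.Unary.All.Properties as All
open import Data.List.Relation.Unary.AllPairs as AllPairs using (AllPairs; []; _∷_)
import Data.List.Relation.Unary.AllPairs.Properties as AllPairs
open import Data.List.Relation.Unary.Any using (here)
open import Data.List.Membership.Propositional using (_∈_)
open import Data.List.Membership.Propositional.Properties using (∈-++⁺ʳ; ∈-map⁺)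
open import Data.List.Relation.Binary.Sublist.Propositional using (_⊆_; ⊆-refl)
open import Data.List.Relation.Binary.Sublist.Propositional.Properties as Sublist
  using (filter-⊆; length-mono-≤; ++⁺ˡ; ++⁺ʳ)
open import Data.Product using (_,_; ∃-syntax)
open import Data.Sum using (inj₁; inj₂)
open import Data.Empty using (⊥-elim)
open import Function using (_∘_)
open import Function.Bundles using (mk⇔)
open import Function.Definitions using (Injective)
open import Relation.Nullary using (¬_; yes; no)
open import Relation.Unary using (Pred; Decidable)
open import Relation.Binary.PropositionalEquality
  using (_≡_; _≢_; refl; sym; trans; cong; cong₂; subst; ≢-sym)
open ℕ.≤-Reasoning

private
  variable
    m k p : ℕ
    x y z : Fin m
    u v w : Word m

restrict-filter : (S : Fin m → Bool) (w : Word m) → restrict S w ≡ filter (T? ∘ S) w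
restrict-filter S [] = refl
restrict-filter S (z ∷ w) with S z
... | true  = cong (z ∷_) (restrict-filter S w)
... | false = restrict-filter S w

restrict-⊆ : (S : Fin m → Bool) (w : Word m) → restrict S w ⊆ w
restrict-⊆ S w = subst (_⊆ w) (sym (restrict-filter S w)) (filter-⊆ (T? ∘ S) w)

filter-≟-filter : ∀ {ℓ} {Q : Pred (Fin m) ℓ} (Q? : Decidable Q) → Q x → (w : Word m) →
                  filter (_≟ x) (filter Q? w) ≡ filter (_≟ x) w
filter-≟-filter Q? Qx [] = refl
filter-≟-filter {x = x} Q? Qx (z ∷ w) with Q? z
... | yes _ with z ≟ x
...   | yes _ = cong (z ∷_) (filter-≟-filter Q? Qx w)
...   | no _  = filter-≟-filter Q? Qx w
filter-≟-filter {x = x} Q? Qx (z ∷ w) | no ¬Qz with z ≟ x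
...   | yes refl = ⊥-elim (¬Qz Qx)
...   | no _     = filter-≟-filter Q? Qx w

occ-here : (x : Fin m) (w : Word m) → occ x (x ∷ w) ≡ suc (occ x w)
occ-here x w = cong length (filter-accept (_≟ x) refl)

occ-there : z ≢ x → occ x (z ∷ w) ≡ occ x w
occ-there {x = x} z≢x = cong length (filter-reject (_≟ x) z≢x)

occ-++ : (x : Fin m) (u v : Word m) → occ x (u ++ v) ≡ occ x u + occ x v
occ-++ x u v = trans (cong length (filter-++ (_≟ x) u v)) (length-++ (filter (_≟ x) u))

occ-all : All (_≡ x) w → occ x w ≡ length w
occ-all {x = x} all≡x = cong length (filter-all (_≟ x) all≡x)

occ-none : All (_≢ x) w → occ x w ≡ 0
occ-none {x = x} all≢x = cong length (filter-none (_≟ x) all≢x)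

occ-map : {f : Fin m → Fin k} → Injective _≡_ _≡_ f → (x : Fin m) (w : Word m) →
          occ (f x) (map f w) ≡ occ x w
occ-map f-inj x [] = refl
occ-map {f = f} f-inj x (z ∷ w) with z ≟ x
... | yes refl = trans (occ-here (f x) (map f w)) (cong suc (occ-map f-inj x w))
... | no z≢x   = trans (occ-there (z≢x ∘ f-inj)) (occ-map f-inj x w)

occ-mono : (x : Fin m) → u ⊆ v → occ x u ≤ occ x v
occ-mono x u⊆v = length-mono-≤ (Sublist.filter⁺ (_≟ x) (_≟ x) (λ { refl z≡x → z≡x }) u⊆v)

occ-restrict : (S : Fin m → Bool) → S x ≡ true → (w : Word m) → occ x (restrict S w) ≡ occ x w
occ-restrict {x = x} S Sx w = begin-equality
  occ x (restrict S w)        ≡⟨ cong (occ x) (restrict-filter S w) ⟩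
  occ x (filter (T? ∘ S) w)   ≡⟨ cong length (filter-≟-filter (T? ∘ S) (subst T (sym Sx) tt) w) ⟩
  occ x w                     ∎

Sorted : Word m → Set
Sorted = AllPairs Fin._≤_

AllPairs-++⁻ʳ : ∀ {a r} {A : Set a} {R : A → A → Set r} (xs : List A) {ys : List A} →
                AllPairs R (xs ++ ys) → AllPairs R ys
AllPairs-++⁻ʳ []       rs       = rs
AllPairs-++⁻ʳ (_ ∷ xs) (_ ∷ rs) = AllPairs-++⁻ʳ xs rs

sorted-restrict : (S : Fin m → Bool) → Sorted w → Sorted (restrict S w)
sorted-restrict {w = w} S sorted =
  subst Sorted (sym (restrict-filter S w)) (AllPairs.filter⁺ (T? ∘ S) sorted)

sorted-between : (c : Fin m) (X Y : Word m) → Sorted (c ∷ X ++ c ∷ Y) → All (_≡ c) X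
sorted-between c []      Y _ = []
sorted-between c (y ∷ X) Y ((c≤y ∷ c≤rest) ∷ y≤rest ∷ sorted) =
  ≤-antisym (All.lookup y≤rest (∈-++⁺ʳ X (here refl))) c≤y ∷ sorted-between c X Y (c≤rest ∷ sorted)

sorted-square : Sorted u → HasSquareFactor p u → ∃[ c ] 2 * p ≤ occ c u
sorted-square sorted (a , [] , b , _ , () , _)
sorted-square {p = p} sorted (a , X@(c ∷ X′) , b , refl , _ , p≤|X|) = c , (begin
  2 * p                  ≤⟨ ℕ.*-monoʳ-≤ 2 p≤|X| ⟩
  2 * length X           ≡⟨ cong (length X +_) (ℕ.+-identityʳ (length X)) ⟩
  length X + length X    ≡⟨ cong₂ _+_ (occ-all all≡c) (occ-all all≡c) ⟨
  occ c X + occ c X      ≡⟨ occ-++ c X X ⟨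
  occ c (X ++ X)         ≤⟨ occ-mono c square⊆u ⟩
  occ c (a ++ X ++ X ++ b) ∎)
  where
  square⊆u : X ++ X ⊆ a ++ X ++ X ++ b
  square⊆u = ++⁺ˡ a (Sublist.++⁺ (⊆-refl {x = X}) (++⁺ʳ b ⊆-refl))

  all≡c : All (_≡ c) X
  all≡c = refl ∷ sorted-between c X′ (X′ ++ b) (AllPairs-++⁻ʳ a sorted)

sorted⇒completeSquareFree : Sorted w → (∀ x → occ x w < 2 * p) → CompleteSquareFree p w
sorted⇒completeSquareFree {w = w} sorted rare (S , square)
  with c , often ← sorted-square (sorted-restrict S sorted) square =
  ℕ.<⇒≱ (rare c) (ℕ.≤-trans often (occ-mono c (restrict-⊆ S w)))

pair-left : (x y : Fin m) → pair x y x ≡ true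
pair-left x y with x ≟ x | x ≟ y
... | yes _  | _ = refl
... | no x≢x | _ = ⊥-elim (x≢x refl)

pair-right : (x y : Fin m) → pair x y y ≡ true
pair-right x y with y ≟ x | y ≟ y
... | yes _ | _      = refl
... | no _  | yes _  = refl
... | no _  | no y≢y = ⊥-elim (y≢y refl)

occ-sorted-altWord : x ≢ y → (k : ℕ) → Sorted (altWord x y k) → occ x (altWord x y k) ≤ 1
occ-sorted-altWord x≢y 0 _ = z≤n
occ-sorted-altWord {x = x} x≢y 1 _ = ℕ.≤-reflexive (occ-here x [])
occ-sorted-altWord {x = x} {y} x≢y 2 _ =
  ℕ.≤-reflexive (trans (occ-here x [ y ]) (cong suc (occ-there (≢-sym x≢y))))
occ-sorted-altWord {x = x} {y} x≢y (suc (suc (suc k))) sorted =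
  ⊥-elim (x≢y (sym (All.head (sorted-between x [ y ] (altWord y x k) sorted))))

sorted-restrict-≢-altWord : (S : Fin m → Bool) → Sorted w → S x ≡ true → x ≢ y → 2 ≤ occ x w →
                            restrict S w ≢ altWord x y k
sorted-restrict-≢-altWord {w = w} {x = x} {k = k} S sorted Sx x≢y twice eq =
  ℕ.<⇒≱ (subst (2 ≤_) (trans (sym (occ-restrict S Sx w)) (cong (occ x) eq)) twice)
        (occ-sorted-altWord x≢y k (subst Sorted eq (sorted-restrict S sorted)))

sorted⇒¬alternate : Sorted w → 2 ≤ occ x w → 2 ≤ occ y w → ¬ Alternate w x y
sorted⇒¬alternate {x = x} {y} sorted twiceˣ twiceʸ (x≢y , k , inj₁ eq) =
  sorted-restrict-≢-altWord (pair x y) sorted (pair-left x y) x≢y twiceˣ eq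
sorted⇒¬alternate {x = x} {y} sorted twiceˣ twiceʸ (x≢y , k , inj₂ eq) =
  sorted-restrict-≢-altWord (pair x y) sorted (pair-right x y) (≢-sym x≢y) twiceʸ eq

edgeless-represents : (G : SimpleGraph) {w : Word (n G)} → Edgeless G →
                      (∀ x → x ∈ w) → (∀ x y → ¬ Alternate w x y) → Represents G w
edgeless-represents G edgeless all∈ ¬alternate =
  all∈ , λ x y _ → mk⇔ (⊥-elim ∘ ¬alternate x y) (⊥-elim ∘ edgeless x y)

blocks : ℕ → (m : ℕ) → Word m
blocks k zero    = []
blocks k (suc m) = replicate k Fin.zero ++ map Fin.suc (blocks k m)

occ-blocks : (k m : ℕ) (x : Fin m) → occ x (blocks k m) ≡ k
occ-blocks k (suc m) Fin.zero = begin-equality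
  occ Fin.zero (replicate k Fin.zero ++ map Fin.suc (blocks k m))
    ≡⟨ occ-++ Fin.zero (replicate k Fin.zero) _ ⟩
  occ Fin.zero (replicate k Fin.zero) + occ Fin.zero (map Fin.suc (blocks k m))
    ≡⟨ cong₂ _+_ (occ-all (All.replicate⁺ k refl)) (occ-none (All.map⁺ {f = Fin.suc} (All.universal (λ _ ()) (blocks k m)))) ⟩
  length (replicate k Fin.zero) + 0
    ≡⟨ trans (ℕ.+-identityʳ _) (length-replicate k) ⟩
  k ∎
occ-blocks k (suc m) (Fin.suc x) = begin-equality
  occ (Fin.suc x) (replicate k Fin.zero ++ map Fin.suc (blocks k m))
    ≡⟨ occ-++ (Fin.suc x) (replicate k Fin.zero) _ ⟩
  occ (Fin.suc x) (replicate k Fin.zero) + occ (Fin.suc x) (map Fin.suc (blocks k m))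
    ≡⟨ cong₂ _+_ (occ-none (All.replicate⁺ k λ ())) (occ-map suc-injective x (blocks k m)) ⟩
  occ x (blocks k m)
    ≡⟨ occ-blocks k m x ⟩
  k ∎

∈-blocks : (k m : ℕ) (x : Fin m) → x ∈ blocks (suc k) m
∈-blocks k (suc m) Fin.zero    = here refl
∈-blocks k (suc m) (Fin.suc x) =
  ∈-++⁺ʳ (replicate (suc k) Fin.zero) (∈-map⁺ Fin.suc (∈-blocks k m x))

sorted-zeros-++ : (k : ℕ) {v : Word (suc m)} → Sorted v → Sorted (replicate k Fin.zero ++ v)
sorted-zeros-++ zero    sorted = sorted
sorted-zeros-++ (suc k) sorted = All.universal (λ _ → z≤n) _ ∷ sorted-zeros-++ k sorted

sorted-blocks : (k m : ℕ) → Sorted (blocks k m)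
sorted-blocks k zero    = []
sorted-blocks k (suc m) = sorted-zeros-++ k (AllPairs.map⁺ (AllPairs.map s≤s (sorted-blocks k m)))

blocks-half-length : (m : ℕ) → 1 ≤ m → 2 ≤ ⌈ length (blocks 3 m) /2⌉
blocks-half-length (suc m) _ = s≤s (s≤s z≤n)

mainTheorem8 : (G : SimpleGraph) → 1 ≤ n G → Edgeless G → PCSFUWR 2 G
mainTheorem8 G 1≤n edgeless =
  blocks 3 (n G) ,
  edgeless-represents G edgeless (∈-blocks 2 (n G))
    (λ x y → sorted⇒¬alternate sorted (twice x) (twice y)) ,
  (3 , occ-blocks 3 (n G)) ,
  sorted⇒completeSquareFree sorted (λ x → ℕ.≤-reflexive (cong suc (occ-blocks 3 (n G) x))) ,
  s≤s z≤n ,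
  blocks-half-length (n G) 1≤n
  where
  sorted : Sorted (blocks 3 (n G))
  sorted = sorted-blocks 3 (n G)

  twice : ∀ x → 2 ≤ occ x (blocks 3 (n G))
  twice x = subst (2 ≤_) (sym (occ-blocks 3 (n G) x)) (s≤s (s≤s z≤n))
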